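{- For every non-negative integer $n$, \[ \sum_{r=0}^{n}\frac{(-1)^r(2r+1)}{(2n+1-2r)!\,(2n+3+2r)!}=\frac{4^n}{(4n+3)!}. \] -}

module Defs where

open import Data.Nat using (ℕ; zero; suc; _+_; _*_; _∸_; _^_)
open import Data.Nat.Properties using (_!*_!≢0; _!≢0)
open import Data.Nat.Base using (_!)
open import Data.Integer using (ℤ; +_; -_)
open import Data.Rational using (ℚ; _/_) renaming (_+_ to _+ℚ_; 0ℚ to 0ℚ)

sign : ℕ → ℤ
sign zero = + 1
sign (suc r) = - sign r

sumTo : ℕ → (ℕ → ℚ) → ℚ
sumTo zero f = f 0
sumTo (suc n) f = sumTo n f +ℚ f (suc n)

term : ℕ → ℕ → ℚ
term n r = (sign r Data.Integer.* (+ (2 * r + 1))) /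
           ((2 * n + 1 ∸ 2 * r) ! * (2 * n + 3 + 2 * r) !)
  where instance _ = (2 * n + 1 ∸ 2 * r) !* (2 * n + 3 + 2 * r) !≢0

rhs : ℕ → ℚ
rhs n = (+ (4 ^ n)) / ((4 * n + 3) !)
  where instance _ = (4 * n + 3) !≢0

{-# OPTIONS --safe #-}
module Submission where

open import Defs
open import Data.Nat using (ℕ)
open import Relation.Binary.PropositionalEquality using (_≡_)

-- Multiplied by (4n+4)!, the identity says Σ_{r ≤ n} (-1)^r (2r+1) C(4n+4, 2n+3+2r) = (2n+2) 2^(2n+1):
-- the case N = 2n+2 of S(N) = N 2^(N-1), where S(N) = Σ_{k=0}^{N} k sin(kπ/2) C(2N, N+k)
-- (only odd k = 2r+1 contribute). As C(2N, N+k) is the coefficient of z^k in (z + 2 + z⁻¹)^N,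
-- every half-row sum Σ_{k=0}^{N} w_k C(2N, N+k) obeys a recursion in N: Pascal's rule applied
-- twice, reflected at k = 0. For w_k = cos(kπ/2) it gives 2Σ - C(2N, N) = 2^N, the real part
-- of (2 + i + i⁻¹)^N, and feeding this into the recursion for w_k = k sin(kπ/2) gives
-- S(N+1) = 2 S(N) + 2^N.

module Binomial where
  open import Data.Nat
  open import Data.Nat.Properties
  open import Data.Nat.Combinatorics
  open import Data.Nat.DivMod using (m/n*n≡m)
  open import Data.Nat.Tactic.RingSolver using (solve-∀)
  open import Relation.Binary.PropositionalEquality
  open ≡-Reasoning

  [n+2]C[k+2]≡nCk+2nC[k+1]+nC[k+2] : ∀ n k →
    suc (suc n) C suc (suc k) ≡ n C k + 2 * (n C suc k) + n C suc (suc k)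
  [n+2]C[k+2]≡nCk+2nC[k+1]+nC[k+2] n k = begin
    suc (suc n) C suc (suc k)                           ≡⟨ pascal (suc n) (suc k) ⟨
    suc n C suc k + suc n C suc (suc k)                 ≡⟨ cong₂ _+_ (pascal n k) (pascal n (suc k)) ⟨
    (n C k + n C suc k) + (n C suc k + n C suc (suc k)) ≡⟨ regroup (n C k) (n C suc k) (n C suc (suc k)) ⟩
    n C k + 2 * (n C suc k) + n C suc (suc k)           ∎
    where
    pascal = nCk+nC[k+1]≡[n+1]C[k+1]
    regroup : ∀ a b c → (a + b) + (b + c) ≡ a + 2 * b + c
    regroup = solve-∀

  [m+n]Cm≡[m+n]Cn : ∀ m n → (m + n) C m ≡ (m + n) C n
  [m+n]Cm≡[m+n]Cn m n = trans (nCk≡nC[n∸k] (m≤m+n m n)) (cong ((m + n) C_) (m+n∸m≡n m n))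

  nCk*[k!*[n∸k]!]≡n! : ∀ {n k} → k ≤ n → (n C k) * (k ! * (n ∸ k) !) ≡ n !
  nCk*[k!*[n∸k]!]≡n! {n} {k} k≤n = begin
    (n C k) * (k ! * (n ∸ k) !)               ≡⟨ cong (_* (k ! * (n ∸ k) !)) (nCk≡n!/k![n-k]! k≤n) ⟩
    (n ! / (k ! * (n ∸ k) !)) * (k ! * (n ∸ k) !) ≡⟨ m/n*n≡m (k![n∸k]!∣n! k≤n) ⟩
    n !                                       ∎
    where instance _ = k !* (n ∸ k) !≢0

  coeff : ℕ → ℕ → ℕ
  coeff N k = 2 * N C (k + N)

  coeff-suc-suc : ∀ N k → coeff (suc N) (suc k) ≡ coeff N k + 2 * coeff N (suc k) + coeff N (suc (suc k))
  coeff-suc-suc N k = trans (cong₂ _C_ (*-suc 2 N) (cong suc (+-suc k N)))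
                            ([n+2]C[k+2]≡nCk+2nC[k+1]+nC[k+2] (2 * N) (k + N))

  coeff-suc-zero : ∀ N → coeff (suc N) 0 ≡ 2 * coeff N 0 + 2 * coeff N 1
  coeff-suc-zero zero    = refl
  coeff-suc-zero (suc m) = begin
    2 * suc (suc m) C suc (suc m)                  ≡⟨ cong (_C suc (suc m)) (*-suc 2 (suc m)) ⟩
    suc (suc (2 * suc m)) C suc (suc m)            ≡⟨ [n+2]C[k+2]≡nCk+2nC[k+1]+nC[k+2] (2 * suc m) m ⟩
    row m + 2 * row (suc m) + row (suc (suc m))    ≡⟨ cong (λ x → x + 2 * row (suc m) + row (suc (suc m))) mirror ⟩
    row (suc (suc m)) + 2 * row (suc m) + row (suc (suc m)) ≡⟨ regroup (row (suc m)) (row (suc (suc m))) ⟩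
    2 * row (suc m) + 2 * row (suc (suc m))        ∎
    where
    row = 2 * suc m C_
    2[m+1]≡m+[m+2] : ∀ m → 2 * suc m ≡ m + suc (suc m)
    2[m+1]≡m+[m+2] = solve-∀
    mirror : row m ≡ row (suc (suc m))
    mirror = subst (λ t → t C m ≡ t C suc (suc m)) (sym (2[m+1]≡m+[m+2] m)) ([m+n]Cm≡[m+n]Cn m (suc (suc m)))
    regroup : ∀ a b → b + 2 * a + b ≡ 2 * a + 2 * b
    regroup = solve-∀

  coeff-vanishes : ∀ {N k} → N < k → coeff N k ≡ 0
  coeff-vanishes {N} {k} N<k =
    k>n⇒nCk≡0 (subst (_< k + N) (cong (N +_) (sym (+-identityʳ N))) (+-monoˡ-< N N<k))

open Binomial

open import Data.Nat as ℕ using (zero; suc; _≤_; _!; _∸_; NonZero)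
import Data.Nat.Properties as ℕₚ
open import Data.Integer using (ℤ; +_; -_; _+_; _*_; _-_; 0ℤ; 1ℤ)
import Data.Integer.Properties as ℤₚ
open import Data.Integer.Tactic.RingSolver using (solve-∀)
import Data.Nat.Tactic.RingSolver as NatSolver
open import Data.Nat.Properties using (_!≢0; _!*_!≢0)
open import Data.Nat.Combinatorics using (_C_)
open import Data.Rational as ℚ using (ℚ; _/_; toℚᵘ)
import Data.Rational.Properties as ℚₚ
open import Data.Rational.Unnormalised using (mkℚᵘ; *≡*) renaming (_≃_ to _≃ᵘ_)
import Data.Rational.Unnormalised.Properties as ℚᵘₚ
open import Function using (_∘_)
open import Relation.Binary.PropositionalEquality using (refl; sym; trans; cong; cong₂; module ≡-Reasoning)
open ≡-Reasoning

∑< : ℕ → (ℕ → ℤ) → ℤ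
∑< zero    f = 0ℤ
∑< (suc L) f = f 0 + ∑< L (f ∘ suc)

syntax ∑< L (λ k → e) = ∑[ k < L ] e

∑<-cong : ∀ L {f g} → (∀ k → f k ≡ g k) → ∑< L f ≡ ∑< L g
∑<-cong zero    f≗g = refl
∑<-cong (suc L) f≗g = cong₂ _+_ (f≗g 0) (∑<-cong L (f≗g ∘ suc))

∑<-last : ∀ L f → ∑< (suc L) f ≡ ∑< L f + f L
∑<-last zero    f = ℤₚ.+-comm (f 0) 0ℤ
∑<-last (suc L) f = trans (cong (_+_ (f 0)) (∑<-last L (f ∘ suc))) (sym (ℤₚ.+-assoc (f 0) _ _))

∑<-extend : ∀ L f → f L ≡ 0ℤ → ∑< (suc L) f ≡ ∑< L f
∑<-extend L f fL≡0 = trans (∑<-last L f) (trans (cong (_+_ (∑< L f)) fL≡0) (ℤₚ.+-identityʳ _))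

∑<-zero : ∀ L → ∑< L (λ _ → 0ℤ) ≡ 0ℤ
∑<-zero zero    = refl
∑<-zero (suc L) = cong (_+_ 0ℤ) (∑<-zero L)

∑<-distrib-+ : ∀ L f g → ∑[ k < L ] (f k + g k) ≡ ∑< L f + ∑< L g
∑<-distrib-+ zero    f g = refl
∑<-distrib-+ (suc L) f g =
  trans (cong (_+_ (f 0 + g 0)) (∑<-distrib-+ L (f ∘ suc) (g ∘ suc))) (interchange (f 0) (g 0) _ _)
  where
  interchange : ∀ a b c d → (a + b) + (c + d) ≡ (a + c) + (b + d)
  interchange = solve-∀

∑<-distribˡ-* : ∀ L c f → ∑[ k < L ] (c * f k) ≡ c * ∑< L f
∑<-distribˡ-* zero    c f = sym (ℤₚ.*-zeroʳ c)
∑<-distribˡ-* (suc L) c f =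
  trans (cong (_+_ (c * f 0)) (∑<-distribˡ-* L c (f ∘ suc))) (sym (ℤₚ.*-distribˡ-+ c (f 0) _))

∑<-pairs : ∀ L f → ∑< (2 ℕ.* L) f ≡ ∑[ r < L ] (f (2 ℕ.* r) + f (suc (2 ℕ.* r)))
∑<-pairs zero    f = refl
∑<-pairs (suc L) f = begin
  ∑< (2 ℕ.* suc L) f                                   ≡⟨ cong (λ m → ∑< m f) (ℕₚ.*-suc 2 L) ⟩
  f 0 + (f 1 + ∑< (2 ℕ.* L) (f ∘ suc ∘ suc))           ≡⟨ ℤₚ.+-assoc (f 0) (f 1) _ ⟨
  f 0 + f 1 + ∑< (2 ℕ.* L) (f ∘ suc ∘ suc)             ≡⟨ cong (_+_ (f 0 + f 1)) (∑<-pairs L _) ⟩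
  f 0 + f 1 + ∑[ r < L ] (f (2 ℕ.+ 2 ℕ.* r) + f (3 ℕ.+ 2 ℕ.* r))
    ≡⟨ cong (_+_ (f 0 + f 1)) (∑<-cong L (λ r → cong (λ m → f m + f (suc m)) (ℕₚ.*-suc 2 r))) ⟨
  f 0 + f 1 + ∑[ r < L ] (f (2 ℕ.* suc r) + f (suc (2 ℕ.* suc r))) ∎

+coeff-suc-zero : ∀ N → + coeff (suc N) 0 ≡ + 2 * + coeff N 0 + + 2 * + coeff N 1
+coeff-suc-zero N = trans (cong +_ (coeff-suc-zero N))
  (trans (ℤₚ.pos-+ (2 ℕ.* coeff N 0) (2 ℕ.* coeff N 1))
         (cong₂ _+_ (ℤₚ.pos-* 2 (coeff N 0)) (ℤₚ.pos-* 2 (coeff N 1))))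

+coeff-suc-suc : ∀ N k → + coeff (suc N) (suc k) ≡ + coeff N k + + 2 * + coeff N (suc k) + + coeff N (suc (suc k))
+coeff-suc-suc N k = trans (cong +_ (coeff-suc-suc N k))
  (trans (ℤₚ.pos-+ (coeff N k ℕ.+ 2 ℕ.* coeff N (suc k)) (coeff N (suc (suc k))))
         (cong (_+ + coeff N (suc (suc k))) (trans (ℤₚ.pos-+ (coeff N k) (2 ℕ.* coeff N (suc k)))
                                                   (cong (_+_ (+ coeff N k)) (ℤₚ.pos-* 2 (coeff N (suc k)))))))

halfSum : (ℕ → ℤ) → ℕ → ℤ
halfSum w N = ∑[ k < suc N ] (w k * + coeff N k)

shift : (ℕ → ℤ) → ℕ → ℤ
shift w zero    = 0ℤ
shift w (suc k) = w k

neighbours : (ℕ → ℤ) → ℕ → ℤ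
neighbours w k = w (suc k) + shift w k

halfSum-+ : ∀ u v N → halfSum u N + halfSum v N ≡ halfSum (λ k → u k + v k) N
halfSum-+ u v N = trans (sym (∑<-distrib-+ (suc N) (λ k → u k * + coeff N k) (λ k → v k * + coeff N k)))
                        (∑<-cong (suc N) (λ k → sym (ℤₚ.*-distribʳ-+ (+ coeff N k) (u k) (v k))))

halfSum-extend : ∀ w N j → halfSum w N ≡ ∑[ k < j ℕ.+ suc N ] (w k * + coeff N k)
halfSum-extend w N zero    = refl
halfSum-extend w N (suc j) = trans (halfSum-extend w N j) (sym (∑<-extend (j ℕ.+ suc N) _ vanishes))
  where
  vanishes : w (j ℕ.+ suc N) * + coeff N (j ℕ.+ suc N) ≡ 0ℤ
  vanishes = trans (cong (λ c → w (j ℕ.+ suc N) * + c) (coeff-vanishes (ℕₚ.m≤n+m (suc N) j)))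
                   (ℤₚ.*-zeroʳ (w (j ℕ.+ suc N)))

halfSum-suc : ∀ w N → halfSum w (suc N) ≡ + 2 * halfSum w N + halfSum (neighbours w) N + w 0 * + coeff N 1
halfSum-suc w N = begin
    halfSum w (suc N)
  ≡⟨ cong₂ _+_ (cong (w 0 *_) (+coeff-suc-zero N)) (∑<-cong (suc N) spread) ⟩
    w 0 * (+ 2 * c 0 + + 2 * c 1) + ∑[ k < suc N ] (a k + + 2 * b k + d k)
  ≡⟨ cong (_+_ (w 0 * (+ 2 * c 0 + + 2 * c 1))) split ⟩
    w 0 * (+ 2 * c 0 + + 2 * c 1) + (∑< (suc N) a + + 2 * ∑< (suc N) b + ∑< (suc N) d)
  ≡⟨ regroup (w 0) (c 0) (c 1) (∑< (suc N) a) (∑< (suc N) b) (∑< (suc N) d) ⟩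
    + 2 * (w 0 * c 0 + ∑< (suc N) b) + (∑< (suc N) a + (0ℤ * c 0 + (w 0 * c 1 + ∑< (suc N) d))) + w 0 * c 1
  ≡⟨ cong₂ (λ x y → + 2 * x + (∑< (suc N) a + y) + w 0 * c 1) (halfSum-extend w N 1) (halfSum-extend (shift w) N 2) ⟨
    + 2 * halfSum w N + (halfSum (w ∘ suc) N + halfSum (shift w) N) + w 0 * c 1
  ≡⟨ cong (λ x → + 2 * halfSum w N + x + w 0 * c 1) (halfSum-+ (w ∘ suc) (shift w) N) ⟩
    + 2 * halfSum w N + halfSum (neighbours w) N + w 0 * c 1 ∎
  where
  c a b d : ℕ → ℤ
  c k = + coeff N k
  a k = w (suc k) * c k
  b k = w (suc k) * c (suc k)
  d k = w (suc k) * c (suc (suc k))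
  spread : ∀ k → w (suc k) * + coeff (suc N) (suc k) ≡ a k + + 2 * b k + d k
  spread k = trans (cong (w (suc k) *_) (+coeff-suc-suc N k)) (distrib (w (suc k)) (c k) (c (suc k)) (c (suc (suc k))))
    where
    distrib : ∀ w x y z → w * (x + + 2 * y + z) ≡ w * x + + 2 * (w * y) + w * z
    distrib = solve-∀
  split : ∑[ k < suc N ] (a k + + 2 * b k + d k) ≡ ∑< (suc N) a + + 2 * ∑< (suc N) b + ∑< (suc N) d
  split = trans (∑<-distrib-+ (suc N) (λ k → a k + + 2 * b k) d)
                (cong (_+ ∑< (suc N) d) (trans (∑<-distrib-+ (suc N) a (λ k → + 2 * b k))
                                               (cong (_+_ (∑< (suc N) a)) (∑<-distribˡ-* (suc N) (+ 2) b))))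
  regroup : ∀ w₀ c₀ c₁ x₁ x₂ x₃ → w₀ * (+ 2 * c₀ + + 2 * c₁) + (x₁ + + 2 * x₂ + x₃)
                                 ≡ + 2 * (w₀ * c₀ + x₂) + (x₁ + (0ℤ * c₀ + (w₀ * c₁ + x₃))) + w₀ * c₁
  regroup = solve-∀

cos½π sin½π : ℕ → ℤ
cos½π zero    = 1ℤ
cos½π (suc k) = - sin½π k
sin½π zero    = 0ℤ
sin½π (suc k) = cos½π k

k·sin½π : ℕ → ℤ
k·sin½π k = + k * sin½π k

sin½π-even : ∀ r → sin½π (2 ℕ.* r) ≡ 0ℤ
sin½π-even zero    = refl
sin½π-even (suc r) = trans (cong sin½π (ℕₚ.*-suc 2 r)) (cong -_ (sin½π-even r))

cos½π-even : ∀ r → cos½π (2 ℕ.* r) ≡ sign r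
cos½π-even zero    = refl
cos½π-even (suc r) = trans (cong cos½π (ℕₚ.*-suc 2 r)) (cong -_ (cos½π-even r))

k·sin½π-even : ∀ r → k·sin½π (2 ℕ.* r) ≡ 0ℤ
k·sin½π-even r = trans (cong (+ (2 ℕ.* r) *_) (sin½π-even r)) (ℤₚ.*-zeroʳ (+ (2 ℕ.* r)))

k·sin½π-odd : ∀ r → k·sin½π (suc (2 ℕ.* r)) ≡ sign r * + (2 ℕ.* r ℕ.+ 1)
k·sin½π-odd r = begin
  + suc (2 ℕ.* r) * cos½π (2 ℕ.* r) ≡⟨ cong (+ suc (2 ℕ.* r) *_) (cos½π-even r) ⟩
  + suc (2 ℕ.* r) * sign r          ≡⟨ ℤₚ.*-comm (+ suc (2 ℕ.* r)) (sign r) ⟩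
  sign r * + suc (2 ℕ.* r)          ≡⟨ cong (λ m → sign r * + m) (ℕₚ.+-comm 1 (2 ℕ.* r)) ⟩
  sign r * + (2 ℕ.* r ℕ.+ 1)        ∎

neighbours-cos½π : ∀ k → neighbours cos½π k ≡ 0ℤ
neighbours-cos½π zero    = refl
neighbours-cos½π (suc k) = ℤₚ.+-inverseˡ (cos½π k)

neighbours-k·sin½π-suc : ∀ k → neighbours k·sin½π (suc k) ≡ + 2 * cos½π (suc k)
neighbours-k·sin½π-suc k = collapse (+ k) (sin½π k)
  where
  collapse : ∀ a x → (+ 2 + a) * (- x) + a * x ≡ + 2 * (- x)
  collapse = solve-∀

halfSum-cos½π-suc : ∀ N → halfSum cos½π (suc N) ≡ + 2 * halfSum cos½π N + + coeff N 1
halfSum-cos½π-suc N = begin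
  halfSum cos½π (suc N)                                                ≡⟨ halfSum-suc cos½π N ⟩
  + 2 * halfSum cos½π N + halfSum (neighbours cos½π) N + 1ℤ * + coeff N 1
    ≡⟨ cong (λ x → + 2 * halfSum cos½π N + x + 1ℤ * + coeff N 1) neighbours-vanish ⟩
  + 2 * halfSum cos½π N + 0ℤ + 1ℤ * + coeff N 1                        ≡⟨ simplify (halfSum cos½π N) (+ coeff N 1) ⟩
  + 2 * halfSum cos½π N + + coeff N 1                                  ∎
  where
  neighbours-vanish : halfSum (neighbours cos½π) N ≡ 0ℤ
  neighbours-vanish = trans (∑<-cong (suc N) (λ k → cong (_* + coeff N k) (neighbours-cos½π k))) (∑<-zero (suc N))
  simplify : ∀ h c → + 2 * h + 0ℤ + 1ℤ * c ≡ + 2 * h + c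
  simplify = solve-∀

cos½π-full-row : ∀ N → + 2 * halfSum cos½π N - + coeff N 0 ≡ + (2 ℕ.^ N)
cos½π-full-row zero    = refl
cos½π-full-row (suc N) = begin
  + 2 * halfSum cos½π (suc N) - + coeff (suc N) 0
    ≡⟨ cong₂ (λ x y → + 2 * x - y) (halfSum-cos½π-suc N) (+coeff-suc-zero N) ⟩
  + 2 * (+ 2 * halfSum cos½π N + + coeff N 1) - (+ 2 * + coeff N 0 + + 2 * + coeff N 1)
    ≡⟨ factor (halfSum cos½π N) (+ coeff N 0) (+ coeff N 1) ⟩
  + 2 * (+ 2 * halfSum cos½π N - + coeff N 0)   ≡⟨ cong (+ 2 *_) (cos½π-full-row N) ⟩
  + 2 * + (2 ℕ.^ N)                              ≡⟨ ℤₚ.pos-* 2 (2 ℕ.^ N) ⟨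
  + (2 ℕ.^ suc N)                                ∎
  where
  factor : ∀ h c₀ c₁ → + 2 * (+ 2 * h + c₁) - (+ 2 * c₀ + + 2 * c₁) ≡ + 2 * (+ 2 * h - c₀)
  factor = solve-∀

-- The neighbour weight is 2 cos(kπ/2) except at k = 0, where it is 1 rather than 2.
halfSum-neighbours-k·sin½π : ∀ N → halfSum (neighbours k·sin½π) N ≡ + 2 * halfSum cos½π N - + coeff N 0
halfSum-neighbours-k·sin½π N = begin
  1ℤ * c 0 + ∑[ k < N ] (neighbours k·sin½π (suc k) * c (suc k))
    ≡⟨ cong (_+_ (1ℤ * c 0)) (∑<-cong N (λ k → cong (_* c (suc k)) (neighbours-k·sin½π-suc k))) ⟩
  1ℤ * c 0 + ∑[ k < N ] (+ 2 * cos½π (suc k) * c (suc k))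
    ≡⟨ cong (_+_ (1ℤ * c 0)) (trans (∑<-cong N (λ k → ℤₚ.*-assoc (+ 2) (cos½π (suc k)) (c (suc k))))
                                    (∑<-distribˡ-* N (+ 2) (λ k → cos½π (suc k) * c (suc k)))) ⟩
  1ℤ * c 0 + + 2 * ∑[ k < N ] (cos½π (suc k) * c (suc k))
    ≡⟨ rearrange (c 0) (∑[ k < N ] (cos½π (suc k) * c (suc k))) ⟩
  + 2 * halfSum cos½π N - c 0 ∎
  where
  c : ℕ → ℤ
  c k = + coeff N k
  rearrange : ∀ c₀ s → 1ℤ * c₀ + + 2 * s ≡ + 2 * (1ℤ * c₀ + s) - c₀
  rearrange = solve-∀

halfSum-k·sin½π-suc : ∀ N → halfSum k·sin½π (suc N) ≡ + 2 * halfSum k·sin½π N + + (2 ℕ.^ N)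
halfSum-k·sin½π-suc N = begin
  halfSum k·sin½π (suc N)                                             ≡⟨ halfSum-suc k·sin½π N ⟩
  + 2 * halfSum k·sin½π N + halfSum (neighbours k·sin½π) N + 0ℤ
    ≡⟨ cong (λ x → + 2 * halfSum k·sin½π N + x + 0ℤ) (trans (halfSum-neighbours-k·sin½π N) (cos½π-full-row N)) ⟩
  + 2 * halfSum k·sin½π N + + (2 ℕ.^ N) + 0ℤ                          ≡⟨ ℤₚ.+-identityʳ _ ⟩
  + 2 * halfSum k·sin½π N + + (2 ℕ.^ N)                               ∎

halfSum-k·sin½π : ∀ M → halfSum k·sin½π (suc M) ≡ + (suc M ℕ.* 2 ℕ.^ M)
halfSum-k·sin½π zero    = refl
halfSum-k·sin½π (suc M) = begin
  halfSum k·sin½π (suc (suc M))                    ≡⟨ halfSum-k·sin½π-suc (suc M) ⟩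
  + 2 * halfSum k·sin½π (suc M) + + (2 ℕ.* P)      ≡⟨ cong (λ x → + 2 * x + + (2 ℕ.* P)) (halfSum-k·sin½π M) ⟩
  + 2 * + (suc M ℕ.* P) + + (2 ℕ.* P)              ≡⟨ cast (suc M ℕ.* P) (2 ℕ.* P) ⟨
  + (2 ℕ.* (suc M ℕ.* P) ℕ.+ 2 ℕ.* P)              ≡⟨ cong +_ (collect M P) ⟩
  + (suc (suc M) ℕ.* (2 ℕ.* P))                    ∎
  where
  P = 2 ℕ.^ M
  cast : ∀ x y → + (2 ℕ.* x ℕ.+ y) ≡ + 2 * + x + + y
  cast x y = trans (ℤₚ.pos-+ (2 ℕ.* x) y) (cong (_+ + y) (ℤₚ.pos-* 2 x))
  collect : ∀ m p → 2 ℕ.* (suc m ℕ.* p) ℕ.+ 2 ℕ.* p ≡ suc (suc m) ℕ.* (2 ℕ.* p)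
  collect = NatSolver.solve-∀

k·sin½π-odd-sum : ∀ n → ∑[ r < suc n ] (k·sin½π (suc (2 ℕ.* r)) * + coeff (2 ℕ.* suc n) (suc (2 ℕ.* r)))
                        ≡ + (4 ℕ.^ n ℕ.* suc (4 ℕ.* n ℕ.+ 3))
k·sin½π-odd-sum n = begin
  ∑[ r < suc n ] f (suc (2 ℕ.* r))                    ≡⟨ ∑<-cong (suc n) even-term-vanishes ⟨
  ∑[ r < suc n ] (f (2 ℕ.* r) + f (suc (2 ℕ.* r)))    ≡⟨ ∑<-pairs (suc n) f ⟨
  ∑< (2 ℕ.* suc n) f                                  ≡⟨ ∑<-extend N f (cong (_* c N) (k·sin½π-even (suc n))) ⟨
  halfSum k·sin½π N                                   ≡⟨ cong (halfSum k·sin½π) (ℕₚ.*-suc 2 n) ⟩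
  halfSum k·sin½π (suc (suc (2 ℕ.* n)))               ≡⟨ halfSum-k·sin½π (suc (2 ℕ.* n)) ⟩
  + (suc (suc (2 ℕ.* n)) ℕ.* 2 ℕ.^ suc (2 ℕ.* n))    ≡⟨ cong (λ p → + (suc (suc (2 ℕ.* n)) ℕ.* (2 ℕ.* p))) (ℕₚ.^-*-assoc 2 2 n) ⟨
  + (suc (suc (2 ℕ.* n)) ℕ.* (2 ℕ.* 4 ℕ.^ n))        ≡⟨ cong +_ (regroup n (4 ℕ.^ n)) ⟩
  + (4 ℕ.^ n ℕ.* suc (4 ℕ.* n ℕ.+ 3))                ∎
  where
  N = 2 ℕ.* suc n
  c f : ℕ → ℤ
  c k = + coeff N k
  f k = k·sin½π k * c k
  even-term-vanishes : ∀ r → f (2 ℕ.* r) + f (suc (2 ℕ.* r)) ≡ f (suc (2 ℕ.* r))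
  even-term-vanishes r = trans (cong (λ x → x * c (2 ℕ.* r) + f (suc (2 ℕ.* r))) (k·sin½π-even r))
                               (ℤₚ.+-identityˡ (f (suc (2 ℕ.* r))))
  regroup : ∀ n p → suc (suc (2 ℕ.* n)) ℕ.* (2 ℕ.* p) ≡ p ℕ.* suc (4 ℕ.* n ℕ.+ 3)
  regroup = NatSolver.solve-∀

infixl 7 _/!_
_/!_ : ℤ → ℕ → ℚ
a /! k = (a / k !) {{k !≢0}}

a*e≡b*d⇒a/d≡b/e : ∀ a b d e .{{_ : NonZero d}} .{{_ : NonZero e}} → a * + e ≡ b * + d → a / d ≡ b / e
a*e≡b*d⇒a/d≡b/e a b (suc d) (suc e) eq = ℚₚ.fromℚᵘ-cong {mkℚᵘ a d} {mkℚᵘ b e} (*≡* eq)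

a/d+b/d≡[a+b]/d : ∀ a b d .{{_ : NonZero d}} → a / d ℚ.+ b / d ≡ (a + b) / d
a/d+b/d≡[a+b]/d a b (suc d) =
  trans (sym (ℚₚ.fromℚᵘ-toℚᵘ (a / suc d ℚ.+ b / suc d))) (ℚₚ.fromℚᵘ-cong sum≃)
  where
  same-denominator : (a * + suc d + b * + suc d) * + suc d ≡ (a + b) * + (suc d ℕ.* suc d)
  same-denominator = trans (factor a b (+ suc d)) (cong ((a + b) *_) (sym (ℤₚ.pos-* (suc d) (suc d))))
    where
    factor : ∀ a b e → (a * e + b * e) * e ≡ (a + b) * (e * e)
    factor = solve-∀
  sum≃ : toℚᵘ (a / suc d ℚ.+ b / suc d) ≃ᵘ mkℚᵘ (a + b) d
  sum≃ = ℚᵘₚ.≃-trans (ℚₚ.toℚᵘ-homo-+ (a / suc d) (b / suc d))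
           (ℚᵘₚ.≃-trans (ℚᵘₚ.+-cong (ℚₚ.toℚᵘ-fromℚᵘ (mkℚᵘ a d)) (ℚₚ.toℚᵘ-fromℚᵘ (mkℚᵘ b d)))
                        (*≡* same-denominator))

+[m*[k+1]]/![k+1]≡+m/!k : ∀ m k → + (m ℕ.* suc k) /! suc k ≡ + m /! k
+[m*[k+1]]/![k+1]≡+m/!k m k = a*e≡b*d⇒a/d≡b/e (+ (m ℕ.* suc k)) (+ m) (suc k !) (k !) (begin
  + (m ℕ.* suc k) * + (k !)    ≡⟨ ℤₚ.pos-* (m ℕ.* suc k) (k !) ⟨
  + (m ℕ.* suc k ℕ.* k !)      ≡⟨ cong +_ (ℕₚ.*-assoc m (suc k) (k !)) ⟩
  + (m ℕ.* (suc k ℕ.* k !))    ≡⟨ ℤₚ.pos-* m (suc k !) ⟩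
  + m * + (suc k !)            ∎)
  where instance
    _ = suc k !≢0
    _ = k !≢0

sumTo-cong : ∀ m {f g : ℕ → ℚ} → (∀ r → r ≤ m → f r ≡ g r) → sumTo m f ≡ sumTo m g
sumTo-cong zero    f≗g = f≗g 0 ℕ.z≤n
sumTo-cong (suc m) f≗g =
  cong₂ ℚ._+_ (sumTo-cong m (λ r r≤m → f≗g r (ℕₚ.m≤n⇒m≤1+n r≤m))) (f≗g (suc m) ℕₚ.≤-refl)

sumTo-/ : ∀ m g d .{{_ : NonZero d}} → sumTo m (λ r → g r / d) ≡ ∑< (suc m) g / d
sumTo-/ zero    g d = cong (λ x → x / d) (sym (ℤₚ.+-identityʳ (g 0)))
sumTo-/ (suc m) g d = begin
  sumTo m (λ r → g r / d) ℚ.+ g (suc m) / d ≡⟨ cong (ℚ._+ g (suc m) / d) (sumTo-/ m g d) ⟩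
  ∑< (suc m) g / d ℚ.+ g (suc m) / d        ≡⟨ a/d+b/d≡[a+b]/d (∑< (suc m) g) (g (suc m)) d ⟩
  (∑< (suc m) g + g (suc m)) / d            ≡⟨ cong (λ x → x / d) (∑<-last (suc m) g) ⟨
  ∑< (suc (suc m)) g / d                    ∎

term≡k·sin½π-odd-summand/[4n+4]! : ∀ {n r} → r ≤ n →
  term n r ≡ (k·sin½π (suc (2 ℕ.* r)) * + coeff (2 ℕ.* suc n) (suc (2 ℕ.* r))) /! suc (4 ℕ.* n ℕ.+ 3)
term≡k·sin½π-odd-summand/[4n+4]! {n} {r} r≤n =
  a*e≡b*d⇒a/d≡b/e a (k·sin½π (suc t) * + c) (p ! ℕ.* q !) (suc (4 ℕ.* n ℕ.+ 3) !) (begin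
  a * + (suc (4 ℕ.* n ℕ.+ 3) !)               ≡⟨ cong (λ m → a * + m) [4n+4]!≡c*[p!*q!] ⟩
  a * + (c ℕ.* (p ! ℕ.* q !))                 ≡⟨ cong (a *_) (ℤₚ.pos-* c (p ! ℕ.* q !)) ⟩
  a * (+ c * + (p ! ℕ.* q !))                 ≡⟨ ℤₚ.*-assoc a (+ c) (+ (p ! ℕ.* q !)) ⟨
  a * + c * + (p ! ℕ.* q !)                   ≡⟨ cong (λ x → x * + c * + (p ! ℕ.* q !)) (k·sin½π-odd r) ⟨
  k·sin½π (suc (2 ℕ.* r)) * + c * + (p ! ℕ.* q !) ∎)
  where
  a = sign r * + (2 ℕ.* r ℕ.+ 1)
  A B t : ℕ
  A = 2 ℕ.* n ℕ.+ 3
  B = 2 ℕ.* n ℕ.+ 1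
  t = 2 ℕ.* r
  p = B ∸ t
  q = A ℕ.+ t
  c = coeff (2 ℕ.* suc n) (suc t)
  t≤B : t ≤ B
  t≤B = ℕₚ.≤-trans (ℕₚ.*-monoʳ-≤ 2 r≤n) (ℕₚ.m≤m+n (2 ℕ.* n) 1)
  4n+4≡A+B : ∀ n → suc (4 ℕ.* n ℕ.+ 3) ≡ (2 ℕ.* n ℕ.+ 3) ℕ.+ (2 ℕ.* n ℕ.+ 1)
  4n+4≡A+B = NatSolver.solve-∀
  2[2[n+1]]≡A+B : ∀ n → 2 ℕ.* (2 ℕ.* suc n) ≡ (2 ℕ.* n ℕ.+ 3) ℕ.+ (2 ℕ.* n ℕ.+ 1)
  2[2[n+1]]≡A+B = NatSolver.solve-∀
  [t+1]+2[n+1]≡A+t : ∀ n t → suc t ℕ.+ 2 ℕ.* suc n ≡ (2 ℕ.* n ℕ.+ 3) ℕ.+ t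
  [t+1]+2[n+1]≡A+t = NatSolver.solve-∀
  instance
    _ = p !* q !≢0
    _ = suc (4 ℕ.* n ℕ.+ 3) !≢0
  [4n+4]!≡c*[p!*q!] : suc (4 ℕ.* n ℕ.+ 3) ! ≡ c ℕ.* (p ! ℕ.* q !)
  [4n+4]!≡c*[p!*q!] = begin
    suc (4 ℕ.* n ℕ.+ 3) !                                ≡⟨ cong _! (4n+4≡A+B n) ⟩
    (A ℕ.+ B) !                                          ≡⟨ nCk*[k!*[n∸k]!]≡n! (ℕₚ.+-monoʳ-≤ A t≤B) ⟨
    ((A ℕ.+ B) C q) ℕ.* (q ! ℕ.* (A ℕ.+ B ∸ q) !)
      ≡⟨ cong (λ m → ((A ℕ.+ B) C q) ℕ.* (q ! ℕ.* m !)) (ℕₚ.[m+n]∸[m+o]≡n∸o A B t) ⟩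
    ((A ℕ.+ B) C q) ℕ.* (q ! ℕ.* p !)
      ≡⟨ cong₂ ℕ._*_ (sym (cong₂ _C_ (2[2[n+1]]≡A+B n) ([t+1]+2[n+1]≡A+t n t))) (ℕₚ.*-comm (q !) (p !)) ⟩
    c ℕ.* (p ! ℕ.* q !)                                  ∎

mainTheorem7 : (n : ℕ) → sumTo n (term n) ≡ rhs n
mainTheorem7 n = begin
  sumTo n (term n)                               ≡⟨ sumTo-cong n (λ r → term≡k·sin½π-odd-summand/[4n+4]!) ⟩
  sumTo n (λ r → oddSummand r /! suc K)          ≡⟨ sumTo-/ n oddSummand (suc K !) ⟩
  ∑< (suc n) oddSummand /! suc K                 ≡⟨ cong (_/! suc K) (k·sin½π-odd-sum n) ⟩
  + (4 ℕ.^ n ℕ.* suc K) /! suc K                 ≡⟨ +[m*[k+1]]/![k+1]≡+m/!k (4 ℕ.^ n) K ⟩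
  rhs n                                          ∎
  where
  K = 4 ℕ.* n ℕ.+ 3
  instance _ = suc K !≢0
  oddSummand : ℕ → ℤ
  oddSummand r = k·sin½π (suc (2 ℕ.* r)) * + coeff (2 ℕ.* suc n) (suc (2 ℕ.* r))
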